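{- Let $T$ be a singular tree and let $\mathbf{Q}$ be the $|CV|\times|N(CV)|$ submatrix of the adjacency matrix of $T$ with rows indexed by the set $CV$ of core vertices and columns indexed by the set $N(CV)$ of vertices adjacent to some core vertex. Then the columns of $\mathbf{Q}$ are linearly independent.
   Context: For the $\{0,1\}$-adjacency matrix $\mathbf{A}$ of $T$, $T$ is singular if $\ker\mathbf{A}\neq\{\mathbf{0}\}$, and a vertex $v$ is a core vertex if some $\mathbf{x}\in\ker\mathbf{A}$ has $x_v\neq0$. In a singular tree the core vertices form an independent set, so $T$ is core-labelled (vertices ordered as $CV$, then $N(CV)$, then the remaining vertices).
   Formalization: Kernel vectors of the adjacency matrix, which define singularity and the core vertices, and the coefficients in the linear independence of the columns of $\mathbf{Q}$ are taken over ℚ. -}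

module Defs where

open import Data.Nat using (ℕ; zero; suc; _≤_)
open import Data.Fin using (Fin; zero; suc)
open import Data.Bool using (Bool; true; false; if_then_else_)
open import Data.List using (List; []; _∷_; _++_; [_]; length)
open import Data.List.Relation.Unary.Unique.Propositional using (Unique)
open import Data.Product using (Σ; ∃; ∃-syntax; _×_; _,_)
open import Data.Rational using (ℚ; 0ℚ; 1ℚ; _+_; _*_)
open import Relation.Binary.PropositionalEquality using (_≡_; _≢_)
open import Relation.Nullary using (¬_)

record Graph (n : ℕ) : Set where
  field
    adj      : Fin n → Fin n → Bool
    symmetric   : ∀ i j → adj i j ≡ adj j i
    irreflexive : ∀ i → adj i i ≡ false
open Graph public

Adj : ∀ {n} → Graph n → Fin n → Fin n → Set
Adj G u v = adj G u v ≡ true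

data Walk {n} (G : Graph n) : Fin n → Fin n → Set where
  here : ∀ {u} → Walk G u u
  step : ∀ {u w v} → Adj G u w → Walk G w v → Walk G u v

Connected : ∀ {n} → Graph n → Set
Connected G = ∀ u v → Walk G u v

data Chain {n} (G : Graph n) : List (Fin n) → Set where
  nil  : Chain G []
  one  : ∀ {u} → Chain G (u ∷ [])
  cons : ∀ {u w vs} → Adj G u w → Chain G (w ∷ vs) → Chain G (u ∷ w ∷ vs)

HasCycle : ∀ {n} → Graph n → Set
HasCycle {n} G = Σ (Fin n) λ u → Σ (List (Fin n)) λ vs →
  (2 ≤ length vs) × Unique (u ∷ vs) × Chain G ((u ∷ vs) ++ [ u ])

IsTree : ∀ {n} → Graph n → Set
IsTree G = Connected G × ¬ HasCycle G

∑ : ∀ {n} → (Fin n → ℚ) → ℚ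
∑ {zero}  f = 0ℚ
∑ {suc n} f = f zero + ∑ (λ i → f (suc i))

adjMatrix : ∀ {n} → Graph n → Fin n → Fin n → ℚ
adjMatrix G i j = if adj G i j then 1ℚ else 0ℚ

InKernel : ∀ {n} → Graph n → (Fin n → ℚ) → Set
InKernel G x = ∀ i → ∑ (λ j → adjMatrix G i j * x j) ≡ 0ℚ

Singular : ∀ {n} → Graph n → Set
Singular {n} G = Σ (Fin n → ℚ) λ x → InKernel G x × (∃[ v ] x v ≢ 0ℚ)

CoreVertex : ∀ {n} → Graph n → Fin n → Set
CoreVertex {n} G v = Σ (Fin n → ℚ) λ x → InKernel G x × x v ≢ 0ℚ

InNCV : ∀ {n} → Graph n → Fin n → Set
InNCV G w = ∃[ v ] (CoreVertex G v × Adj G v w)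

-- The columns of Q = A[CV, N(CV)] are linearly independent: any coefficient
-- vector c indexed by N(CV) (encoded as c : Fin n → ℚ vanishing outside N(CV))
-- with Q c = 0 (i.e. (A c)_v = 0 for every v ∈ CV) is zero.
ColumnsOfQIndependent : ∀ {n} → Graph n → Set
ColumnsOfQIndependent {n} G =
  (c : Fin n → ℚ) →
  (∀ w → ¬ InNCV G w → c w ≡ 0ℚ) →
  (∀ v → CoreVertex G v → ∑ (λ w → adjMatrix G v w * c w) ≡ 0ℚ) →
  ∀ w → c w ≡ 0ℚ

-- Call a vertex marked if it lies in N(CV) and carries a nonzero coefficient of c,
-- or if it is a core vertex adjacent to such a vertex. A marked vertex u of N(CV) is
-- adjacent to a core vertex v, and a kernel vector x with x v ≠ 0 has row sum
-- (A x)_u = 0, so x is nonzero at a second neighbour of u, which is again core and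
-- marked. Dually, for a marked core vertex u the relation (A c)_u = 0 forces a
-- second neighbour of u in the support of c. So every marked vertex has two marked
-- neighbours, and a finite graph with such a vertex set, if nonempty, has a cycle.
-- Hence in a tree nothing is marked, that is c = 0.
module Submission where

open import Data.Nat using (ℕ; zero; suc; _≤_; _<_; z≤n; s≤s; _+_)
open import Data.Nat.Properties using (+-suc; m≤m+n; <⇒≱)
open import Data.Fin using (Fin; zero; suc)
import Data.Fin.Properties as Fin
open import Data.Bool using (true; false)
open import Data.List using (List; []; _∷_; _++_; [_]; length; lookup)
open import Data.List.Relation.Unary.All as All using (All; []; _∷_)
open import Data.List.Relation.Unary.All.Properties using (¬Any⇒All¬)
open import Data.List.Relation.Unary.Any using (here; there)
open import Data.List.Relation.Unary.AllPairs using ([]; _∷_)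
open import Data.List.Relation.Unary.Unique.Propositional using (Unique)
open import Data.List.Membership.Propositional using (_∈_)
open import Data.List.Membership.Propositional.Properties using (∈-lookup)
open import Data.Product using (∃; ∃₂; _×_; _,_)
open import Data.Sum using (_⊎_; inj₁; inj₂)
open import Data.Rational using (ℚ; 0ℚ; _*_; _≟_)
import Data.Rational as ℚ
open import Data.Rational.Properties using (+-identityˡ; +-identityʳ; *-identityˡ; *-zeroˡ)
open import Relation.Binary.PropositionalEquality using (_≡_; _≢_; refl; sym; trans; cong; cong₂; subst)
open import Relation.Nullary using (¬_; yes; no; ¬?; contradiction)
open import Relation.Nullary.Decidable using (_×-dec_)
open import Defs

Unique⇒lookup-injective : ∀ {A : Set} {xs : List A} → Unique xs →
  ∀ {i j} → lookup xs i ≡ lookup xs j → i ≡ j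
Unique⇒lookup-injective (_ ∷ _)    {zero}  {zero}  _  = refl
Unique⇒lookup-injective (px ∷ _)   {zero}  {suc j} eq = contradiction eq (All.lookup px (∈-lookup j))
Unique⇒lookup-injective (px ∷ _)   {suc i} {zero}  eq = contradiction (sym eq) (All.lookup px (∈-lookup i))
Unique⇒lookup-injective (_ ∷ pxs)  {suc i} {suc j} eq = cong suc (Unique⇒lookup-injective pxs eq)

Unique⇒length≤ : ∀ {n} {xs : List (Fin n)} → Unique xs → length xs ≤ n
Unique⇒length≤ u = Fin.injective⇒≤ (Unique⇒lookup-injective u)

before : ∀ {A : Set} {x : A} {xs : List A} → x ∈ xs → List A
before                (here _)     = []
before {xs = y ∷ _} (there x∈xs) = y ∷ before x∈xs

All-before : ∀ {A : Set} {P : A → Set} {x : A} {xs : List A} →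
  All P xs → (x∈xs : x ∈ xs) → All P (before x∈xs)
All-before _          (here _)     = []
All-before (py ∷ pys) (there x∈xs) = py ∷ All-before pys x∈xs

Unique-before : ∀ {A : Set} {x : A} {xs : List A} →
  Unique xs → (x∈xs : x ∈ xs) → Unique (x ∷ before x∈xs)
Unique-before _          (here _)        = [] ∷ []
Unique-before (py ∷ pys) (there x∈xs) with Unique-before pys x∈xs
... | x∉ ∷ u = ((λ x≡y → All.lookup py x∈xs (sym x≡y)) ∷ x∉) ∷ All-before py x∈xs ∷ u

∑-zero : ∀ {n} (f : Fin n → ℚ) → (∀ j → f j ≡ 0ℚ) → ∑ f ≡ 0ℚ
∑-zero {zero}  _ _  = refl
∑-zero {suc _} f f≡0 =
  trans (cong₂ ℚ._+_ (f≡0 zero) (∑-zero (λ j → f (suc j)) (λ j → f≡0 (suc j)))) (+-identityˡ 0ℚ)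

∑-single : ∀ {n} (f : Fin n → ℚ) v → (∀ j → j ≢ v → f j ≡ 0ℚ) → ∑ f ≡ f v
∑-single {suc _} f zero f≡0 =
  trans (cong (f zero ℚ.+_) (∑-zero _ (λ j → f≡0 (suc j) λ ()))) (+-identityʳ (f zero))
∑-single {suc _} f (suc v) f≡0 =
  trans (cong₂ ℚ._+_ (f≡0 zero λ ()) (∑-single (λ j → f (suc j)) v
           (λ j j≢v → f≡0 (suc j) (λ sj≡sv → j≢v (Fin.suc-injective sj≡sv)))))
        (+-identityˡ (f (suc v)))

∑≡0⇒otherNonzero : ∀ {n} (f : Fin n → ℚ) → ∑ f ≡ 0ℚ → ∀ v → f v ≢ 0ℚ →
  ∃ λ j → j ≢ v × f j ≢ 0ℚ
∑≡0⇒otherNonzero f ∑f≡0 v fv≢0 with Fin.any? (λ j → ¬? (j Fin.≟ v) ×-dec ¬? (f j ≟ 0ℚ))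
... | yes found = found
... | no none = contradiction (trans (sym (∑-single f v others≡0)) ∑f≡0) fv≢0
  where
  others≡0 : ∀ j → j ≢ v → f j ≡ 0ℚ
  others≡0 j j≢v with f j ≟ 0ℚ
  ... | yes fj≡0 = fj≡0
  ... | no  fj≢0 = contradiction (j , j≢v , fj≢0) none

module _ {n : ℕ} (G : Graph n) where

  open import Data.List.Membership.DecPropositional (Fin._≟_ {n}) using (_∈?_)

  Adj-sym : ∀ {u v} → Adj G u v → Adj G v u
  Adj-sym {u} {v} = trans (symmetric G v u)

  Adj⇒≢ : ∀ {u v} → Adj G u v → u ≢ v
  Adj⇒≢ {u} uv refl with trans (sym (irreflexive G u)) uv
  ... | ()

  Chain-before : ∀ {w vs} → Chain G vs → (w∈vs : w ∈ vs) → Chain G (before w∈vs ++ [ w ])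
  Chain-before _           (here refl)            = one
  Chain-before (cons uv _) (there (here refl))    = cons uv one
  Chain-before (cons uv c) (there w∈vs@(there _)) = cons uv (Chain-before c w∈vs)

  TwoNeighboursIn : (Fin n → Set) → Set
  TwoNeighboursIn P = ∀ u → P u → ∃₂ λ a b → a ≢ b × P a × P b × Adj G u a × Adj G u b

  module _ {P : Fin n → Set} (two : TwoNeighboursIn P) where

    neighbourAvoiding : ∀ {u} → P u → (p : Fin n) → ∃ λ w → w ≢ p × P w × Adj G u w
    neighbourAvoiding {u} pu p with two u pu
    ... | a , b , a≢b , pa , pb , ua , ub with a Fin.≟ p
    ... | yes refl = b , (λ b≡a → a≢b (sym b≡a)) , pb , ub
    ... | no a≢p   = a , a≢p , pa , ua

    -- A path is kept reversed, so its head a is the end being extended.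
    closeCycle : ∀ {w a b rest} → Unique (a ∷ b ∷ rest) → Chain G (a ∷ b ∷ rest) →
      Adj G a w → w ≢ b → w ∈ (a ∷ b ∷ rest) → HasCycle G
    closeCycle _ _ aw _   (here refl)         = contradiction refl (Adj⇒≢ aw)
    closeCycle _ _ _  w≢b (there (here refl)) = contradiction refl w≢b
    closeCycle {w} u c aw _ w∈@(there (there _)) =
      w , before w∈ , s≤s (s≤s z≤n) , Unique-before u w∈ , cons (Adj-sym aw) (Chain-before c w∈)

    -- k bounds the number of further extensions, since a path has at most n vertices.
    extendPath : ∀ k a b rest → P a → Unique (a ∷ b ∷ rest) → Chain G (a ∷ b ∷ rest) →
      n < k + length (a ∷ b ∷ rest) → HasCycle G
    extendPath zero    a b rest _  u _ n<len = contradiction (Unique⇒length≤ u) (<⇒≱ n<len)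
    extendPath (suc k) a b rest pa u c n<len with neighbourAvoiding pa b
    ... | w , w≢b , pw , aw with w ∈? (a ∷ b ∷ rest)
    ... | yes w∈ = closeCycle u c aw w≢b w∈
    ... | no  w∉ = extendPath k w a (b ∷ rest) pw (¬Any⇒All¬ _ w∉ ∷ u) (cons (Adj-sym aw) c)
                     (subst (n <_) (sym (+-suc k (length (a ∷ b ∷ rest)))) n<len)

    twoNeighbours⇒HasCycle : ∀ {u} → P u → HasCycle G
    twoNeighbours⇒HasCycle {u} pu with two u pu
    ... | a , _ , _ , pa , _ , ua , _ =
      extendPath (suc n) a u [] pa ((Adj⇒≢ (Adj-sym ua) ∷ []) ∷ [] ∷ []) (cons (Adj-sym ua) one)
        (m≤m+n (suc n) 2)

  adjMatrix-*-≢0 : ∀ {u j} (y : ℚ) → adjMatrix G u j * y ≢ 0ℚ → Adj G u j × y ≢ 0ℚ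
  adjMatrix-*-≢0 {u} {j} y Auj*y≢0 with adj G u j
  ... | false = contradiction (*-zeroˡ y) Auj*y≢0
  ... | true  = refl , (λ y≡0 → Auj*y≢0 (trans (*-identityˡ y) y≡0))

  Adj⇒adjMatrix-*≡ : ∀ {u j} (y : ℚ) → Adj G u j → adjMatrix G u j * y ≡ y
  Adj⇒adjMatrix-*≡ {u} {j} y uj with adj G u j
  Adj⇒adjMatrix-*≡ y refl | true = *-identityˡ y

  rowSum≡0⇒secondNeighbour : ∀ {u v} (x : Fin n → ℚ) → ∑ (λ j → adjMatrix G u j * x j) ≡ 0ℚ →
    Adj G u v → x v ≢ 0ℚ → ∃ λ v′ → v′ ≢ v × Adj G u v′ × x v′ ≢ 0ℚ
  rowSum≡0⇒secondNeighbour {u} {v} x Ax≡0 uv xv≢0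
    with ∑≡0⇒otherNonzero _ Ax≡0 v (λ Auv*xv≡0 → xv≢0 (trans (sym (Adj⇒adjMatrix-*≡ (x v) uv)) Auv*xv≡0))
  ... | v′ , v′≢v , Auv′*xv′≢0 with adjMatrix-*-≢0 (x v′) Auv′*xv′≢0
  ... | uv′ , xv′≢0 = v′ , v′≢v , uv′ , xv′≢0

module _ {n : ℕ} (T : Graph n) (c : Fin n → ℚ)
         (Qc≡0 : ∀ v → CoreVertex T v → ∑ (λ w → adjMatrix T v w * c w) ≡ 0ℚ) where

  Marked : Fin n → Set
  Marked u = (InNCV T u × c u ≢ 0ℚ) ⊎ (CoreVertex T u × ∃ λ w → Adj T u w × c w ≢ 0ℚ)

  marked-twoNeighbours : TwoNeighboursIn T Marked
  marked-twoNeighbours u (inj₁ ((v , (x , x∈ker , xv≢0) , vu) , cu≢0))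
    with rowSum≡0⇒secondNeighbour T x (x∈ker u) (Adj-sym T vu) xv≢0
  ... | v′ , v′≢v , uv′ , xv′≢0 =
    v , v′ , (λ v≡v′ → v′≢v (sym v≡v′)) ,
    inj₂ ((x , x∈ker , xv≢0) , u , vu , cu≢0) ,
    inj₂ ((x , x∈ker , xv′≢0) , u , Adj-sym T uv′ , cu≢0) ,
    Adj-sym T vu , uv′
  marked-twoNeighbours u (inj₂ (u-core , w , uw , cw≢0))
    with rowSum≡0⇒secondNeighbour T c (Qc≡0 u u-core) uw cw≢0
  ... | w′ , w′≢w , uw′ , cw′≢0 =
    w , w′ , (λ w≡w′ → w′≢w (sym w≡w′)) ,
    inj₁ ((u , u-core , uw) , cw≢0) ,
    inj₁ ((u , u-core , uw′) , cw′≢0) ,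
    uw , uw′

mainTheorem17 : ∀ {n : ℕ} (T : Graph n) → IsTree T → Singular T →
    ColumnsOfQIndependent T
mainTheorem17 T (_ , acyclic) _ c c≡0-off-NCV Qc≡0 w with c w ≟ 0ℚ
... | yes cw≡0 = cw≡0
... | no  cw≢0 = contradiction (c≡0-off-NCV w w∉NCV) cw≢0
  where
  w∉NCV : ¬ InNCV T w
  w∉NCV w∈NCV =
    acyclic (twoNeighbours⇒HasCycle T (marked-twoNeighbours T c Qc≡0) (inj₁ (w∈NCV , cw≢0)))
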